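{- For any positive integers $k$ and $n\geq k+2$, the banana tree $B_{k,n}$ is $B_{1,n}$-supermagic.
   Context: All graphs are finite, undirected and simple. Let $H$ be the graph obtained by taking a star with $n$ vertices and joining an additional vertex $v$ to exactly one leaf of the star. For a positive integer $k$, $A_k(H,v)$ denotes the graph obtained by taking $k$ disjoint copies of $H$ and identifying the $k$ copies of $v$ into a single vertex. The banana tree is $B_{k,n}=A_k(H,v)$ (so $B_{1,n}=H$). A graph $\Gamma=(V,E)$ admits an $H$-covering if every edge belongs to a subgraph isomorphic to $H$; it is $H$-supermagic if there is a bijection $f:V\cup E\to\{1,\dotsc,|V|+|E|\}$ with $f(V)=\{1,\dotsc,|V|\}$ and a constant $c$ such that $\sum_{u\in V(H')}f(u)+\sum_{e\in E(H')}f(e)=c$ for every subgraph $H'\subseteq\Gamma$ with $H'\cong H$. -}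

module Defs where

open import Data.Nat using (ℕ; zero; suc; _+_; _*_; _<_)
open import Data.Fin using (Fin; zero; suc; toℕ; combine; remQuot)
open import Data.Product using (_×_; _,_; Σ)
open import Data.Sum using (_⊎_; inj₁; inj₂)
open import Data.List using (tabulate)
open import Data.Nat.ListAction using (sum)
open import Function.Bundles using (_⤖_; Bijection)
open import Function.Definitions using (Injective)
open import Relation.Binary.PropositionalEquality using (_≡_)

-- A finite graph with vertex set Fin nV and edge set Fin nE;
-- edge e joins the two vertices of (ends e) (orientation irrelevant).
record Graph : Set where
  field
    nV   : ℕ
    nE   : ℕ
    ends : Fin nE → Fin nV × Fin nV
open Graph public

Σ-Fin : ∀ {m} → (Fin m → ℕ) → ℕ
Σ-Fin g = sum (tabulate g)

-- Its image is exactly a subgraph of Γ isomorphic to H, and every such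
-- subgraph arises this way.
record Copy (H Γ : Graph) : Set where
  field
    φV    : Fin (nV H) → Fin (nV Γ)
    φE    : Fin (nE H) → Fin (nE Γ)
    φV-inj : Injective _≡_ _≡_ φV
    φE-inj : Injective _≡_ _≡_ φE
    φ-edge : ∀ e → let (a , b) = ends H e in
               ends Γ (φE e) ≡ (φV a , φV b) ⊎ ends Γ (φE e) ≡ (φV b , φV a)
open Copy public

-- Total labelings: a bijection V ∪ E → {1,…,|V|+|E|}, encoded as a bijection
-- onto Fin (|V|+|E|) with label x = 1 + toℕ(σ x).
Labelling : Graph → Set
Labelling Γ = (Fin (nV Γ) ⊎ Fin (nE Γ)) ⤖ Fin (nV Γ + nE Γ)

label : ∀ Γ → Labelling Γ → Fin (nV Γ) ⊎ Fin (nE Γ) → ℕ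
label Γ σ x = suc (toℕ (Bijection.to σ x))

weight : ∀ H Γ → Labelling Γ → Copy H Γ → ℕ
weight H Γ σ c = Σ-Fin (λ u → label Γ σ (inj₁ (φV c u))) + Σ-Fin (λ e → label Γ σ (inj₂ (φE c e)))

IsSupermagic : (Γ H : Graph) → Set
IsSupermagic Γ H =
  Σ (Labelling Γ) λ σ →
    (∀ v → label Γ σ (inj₁ v) Data.Nat.≤ nV Γ) ×
    Σ ℕ λ c → ∀ (h : Copy H Γ) → weight H Γ σ h ≡ c

-- Banana tree B_{k,n} (meaningful for n ≥ 2).
-- Vertex zero is the common vertex v; vertex suc (combine i j) is vertex j of
-- the i-th star (j = zero the centre, j = suc zero the leaf joined to v).
-- Edge combine i zero joins v to leaf 1 of copy i; edge combine i (suc j')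
-- joins the centre of copy i to its leaf suc j'.
banana : ℕ → ℕ → Graph
banana k (suc (suc m)) = record { nV = suc (k * n) ; nE = k * n ; ends = ed }
  where
  n = suc (suc m)
  ed : Fin (k * n) → Fin (suc (k * n)) × Fin (suc (k * n))
  ed e with remQuot {k} n e
  ... | i , zero   = zero , suc (combine i (suc zero))
  ... | i , suc j' = suc (combine i zero) , suc (combine i (suc j'))
banana k _ = record { nV = 0 ; nE = 0 ; ends = λ () }

-- Label the vertices 1, …, |V| in order and the edges |V|+1, …, |V|+|E| in reverse order;
-- then vertex e+1 and edge e always have label sum |V|+|E|+2.  In the encoding of B_{k,n}
-- this pairs each star centre with its stem and every leaf with its spoke.  For k ≥ 2
-- and n ≥ k+2 the centre of a copy of B_{1,n} has n−1 > max(k, 2) distinct neighbours, more than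
-- the common vertex or any leaf has, so it lands on a star centre; the copy is then that
-- star with its stem and the common vertex, it respects the pairing, and its weight is
-- 1 + n(|V|+|E|+2).  For k = 1 every copy is an automorphism and has the total label sum.
module Submission where

open import Defs
open import Data.Empty using (⊥-elim)
open import Data.List.Properties using (tabulate-cong)
import Data.Nat.ListAction as List
open import Data.Fin using (Fin; zero; suc; toℕ; combine; remQuot; opposite; punchOut)
open import Data.Fin.Properties
  using (+↔⊎; toℕ-↑ˡ; toℕ-↑ʳ; toℕ<n; opposite-prop; opposite-involutive; punchIn-punchOut; punchOut-injective;
         suc-injective; injective⇒≤; remQuot-combine; combine-remQuot)
open import Data.Nat using (ℕ; zero; suc; _+_; _∸_; _≤_; z≤n; s≤s; s≤s⁻¹)
open import Data.Nat.Properties using (+-0-commutativeMonoid; +-assoc; +-comm; m+[n∸m]≡n; ≤-trans; <⇒≱)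
open import Algebra.Properties.CommutativeMonoid.Sum +-0-commutativeMonoid
  using (sum; sum-remove; sum-cong-≗; ∑-distrib-+)
open import Data.Nat.Tactic.RingSolver using (solve-∀)
open import Data.Product using (_×_; _,_; ∃; proj₁; proj₂; uncurry)
open import Data.Sum using (_⊎_; inj₁; inj₂)
import Data.Sum as Sum
open import Data.Vec.Functional using (Vector; removeAt)
open import Function using (_∘_; id)
open import Function.Bundles using (_↔_; mk↔ₛ′)
open import Function.Construct.Composition using (_↔-∘_)
open import Function.Construct.Symmetry using (↔-sym)
open import Function.Definitions using (Injective)
open import Function.Properties.Inverse using (↔⇒⤖)
open import Relation.Binary.PropositionalEquality

Σ-Fin≡sum : ∀ {m} (f : Fin m → ℕ) → Σ-Fin f ≡ sum f
Σ-Fin≡sum {zero}  f = refl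
Σ-Fin≡sum {suc m} f = cong (f zero +_) (Σ-Fin≡sum (f ∘ suc))

Σ-Fin-cong : ∀ {m} {f g : Fin m → ℕ} → (∀ x → f x ≡ g x) → Σ-Fin f ≡ Σ-Fin g
Σ-Fin-cong f≗g = cong List.sum (tabulate-cong f≗g)

Σ-Fin-+ : ∀ {m} (f g : Fin m → ℕ) → Σ-Fin f + Σ-Fin g ≡ Σ-Fin (λ x → f x + g x)
Σ-Fin-+ f g = begin
  Σ-Fin f + Σ-Fin g            ≡⟨ cong₂ _+_ (Σ-Fin≡sum f) (Σ-Fin≡sum g) ⟩
  sum f + sum g                ≡⟨ ∑-distrib-+ f g ⟨
  sum (λ x → f x + g x)        ≡⟨ Σ-Fin≡sum (λ x → f x + g x) ⟨
  Σ-Fin (λ x → f x + g x)      ∎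
  where open ≡-Reasoning

sum-∘-injective : ∀ {m} (f : Fin m → Fin m) → Injective _≡_ _≡_ f → (g : Vector ℕ m) → sum (g ∘ f) ≡ sum g
sum-∘-injective {zero}  f f-inj g = refl
sum-∘-injective {suc m} f f-inj g = begin
  g (f zero) + sum (g ∘ f ∘ suc)               ≡⟨ cong (g (f zero) +_) (sum-cong-≗ (cong g ∘ sym ∘ punchIn-punchOut ∘ f₀≢)) ⟩
  g (f zero) + sum (removeAt g (f zero) ∘ f′)  ≡⟨ cong (g (f zero) +_) (sum-∘-injective f′ f′-inj (removeAt g (f zero))) ⟩
  g (f zero) + sum (removeAt g (f zero))       ≡⟨ sum-remove g ⟨
  sum g                                        ∎
  where
  open ≡-Reasoning
  f₀≢ : ∀ x → f zero ≢ f (suc x)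
  f₀≢ x eq with () ← f-inj eq
  f′ : Fin m → Fin m
  f′ x = punchOut (f₀≢ x)
  f′-inj : Injective _≡_ _≡_ f′
  f′-inj eq = suc-injective (f-inj (punchOut-injective (f₀≢ _) (f₀≢ _) eq))

Σ-Fin-∘-injective : ∀ {m} (f : Fin m → Fin m) → Injective _≡_ _≡_ f → (g : Fin m → ℕ) → Σ-Fin (g ∘ f) ≡ Σ-Fin g
Σ-Fin-∘-injective f f-inj g = begin
  Σ-Fin (g ∘ f)  ≡⟨ Σ-Fin≡sum (g ∘ f) ⟩
  sum (g ∘ f)    ≡⟨ sum-∘-injective f f-inj g ⟩
  sum g          ≡⟨ Σ-Fin≡sum g ⟨
  Σ-Fin g        ∎
  where open ≡-Reasoning

injective-into-image⇒≤ : ∀ {a} {A : Set a} {p q} {f : Fin p → A} → Injective _≡_ _≡_ f →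
                         (g : Fin q → A) → (∀ x → ∃ λ y → f x ≡ g y) → p ≤ q
injective-into-image⇒≤ {f = f} f-inj g covered = injective⇒≤ h-inj
  where
  h-inj : Injective _≡_ _≡_ (proj₁ ∘ covered)
  h-inj {x} {x′} eq = f-inj (trans (proj₂ (covered x)) (trans (cong g eq) (sym (proj₂ (covered x′)))))

Adjacent : (Γ : Graph) → Fin (nV Γ) → Fin (nV Γ) → Fin (nE Γ) → Set
Adjacent Γ a b e = ends Γ e ≡ (a , b) ⊎ ends Γ e ≡ (b , a)

edgeReversed : ∀ Γ → Labelling Γ
edgeReversed Γ = ↔⇒⤖ (↔-sym +↔⊎ ↔-∘ reverseEdges)
  where
  flipEdge : Fin (nV Γ) ⊎ Fin (nE Γ) → Fin (nV Γ) ⊎ Fin (nE Γ)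
  flipEdge = Sum.map id opposite
  flipEdge-involutive : ∀ x → flipEdge (flipEdge x) ≡ x
  flipEdge-involutive (inj₁ v) = refl
  flipEdge-involutive (inj₂ e) = cong inj₂ (opposite-involutive e)
  reverseEdges : (Fin (nV Γ) ⊎ Fin (nE Γ)) ↔ (Fin (nV Γ) ⊎ Fin (nE Γ))
  reverseEdges = mk↔ₛ′ flipEdge flipEdge flipEdge-involutive flipEdge-involutive

label-vertex : ∀ Γ v → label Γ (edgeReversed Γ) (inj₁ v) ≡ suc (toℕ v)
label-vertex Γ v = cong suc (toℕ-↑ˡ v (nE Γ))

label-edge : ∀ Γ e → label Γ (edgeReversed Γ) (inj₂ e) ≡ suc (nV Γ + (nE Γ ∸ suc (toℕ e)))
label-edge Γ e = cong suc (trans (toℕ-↑ʳ (nV Γ) (opposite e)) (cong (nV Γ +_) (opposite-prop e)))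

label-pair : ∀ Γ v e → toℕ v ≡ suc (toℕ e) →
             label Γ (edgeReversed Γ) (inj₁ v) + label Γ (edgeReversed Γ) (inj₂ e) ≡ suc (suc (nV Γ + nE Γ))
label-pair Γ v e v≡1+e = begin
  label Γ σ (inj₁ v) + label Γ σ (inj₂ e)           ≡⟨ cong₂ _+_ (label-vertex Γ v) (label-edge Γ e) ⟩
  suc (toℕ v) + suc (nV Γ + (nE Γ ∸ suc (toℕ e)))   ≡⟨ cong (λ t → suc t + _) v≡1+e ⟩
  suc (suc (toℕ e)) + suc (nV Γ + d)                ≡⟨ shuffle (toℕ e) (nV Γ) d ⟩
  suc (suc (nV Γ + (suc (toℕ e) + d)))              ≡⟨ cong (λ t → suc (suc (nV Γ + t))) (m+[n∸m]≡n (toℕ<n e)) ⟩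
  suc (suc (nV Γ + nE Γ))                           ∎
  where
  open ≡-Reasoning
  σ : Labelling Γ
  σ = edgeReversed Γ
  d : ℕ
  d = nE Γ ∸ suc (toℕ e)
  shuffle : ∀ t V d → suc (suc t) + suc (V + d) ≡ suc (suc (V + (suc t + d)))
  shuffle = solve-∀

isSupermagic-edgeReversed : ∀ {Γ H} c → (∀ h → weight H Γ (edgeReversed Γ) h ≡ c) → IsSupermagic Γ H
isSupermagic-edgeReversed {Γ} c constant =
  edgeReversed Γ , (λ v → subst (_≤ nV Γ) (sym (label-vertex Γ v)) (toℕ<n v)) , c , constant

isSupermagic-self : ∀ Γ → IsSupermagic Γ Γ
isSupermagic-self Γ = isSupermagic-edgeReversed (Σ-Fin labelV + Σ-Fin labelE) λ h →
  cong₂ _+_ (Σ-Fin-∘-injective (φV h) (φV-inj h) labelV) (Σ-Fin-∘-injective (φE h) (φE-inj h) labelE)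
  where
  labelV : Fin (nV Γ) → ℕ
  labelV = label Γ (edgeReversed Γ) ∘ inj₁
  labelE : Fin (nE Γ) → ℕ
  labelE = label Γ (edgeReversed Γ) ∘ inj₂

module BananaTree (k m : ℕ) where

  n : ℕ
  n = suc (suc m)

  Γ : Graph
  Γ = banana k n

  data Vertex : Set where
    root   : Vertex
    centre : Fin k → Vertex
    leaf   : Fin k → Fin (suc m) → Vertex

  data Edge : Set where
    stem  : Fin k → Edge
    spoke : Fin k → Fin (suc m) → Edge

  partner : Edge → Vertex
  partner (stem i)    = centre i
  partner (spoke i t) = leaf i t

  slot : Fin k → Fin n → Edge
  slot i zero    = stem i
  slot i (suc t) = spoke i t

  decodeE : Fin (nE Γ) → Edge
  decodeE e = uncurry slot (remQuot n e)

  encodeE : Edge → Fin (nE Γ)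
  encodeE (stem i)    = combine i zero
  encodeE (spoke i t) = combine i (suc t)

  decodeV : Fin (nV Γ) → Vertex
  decodeV zero    = root
  decodeV (suc x) = partner (decodeE x)

  encodeV : Vertex → Fin (nV Γ)
  encodeV root       = zero
  encodeV (centre i) = suc (encodeE (stem i))
  encodeV (leaf i t) = suc (encodeE (spoke i t))

  encodeE-slot : ∀ i j → encodeE (slot i j) ≡ combine i j
  encodeE-slot i zero    = refl
  encodeE-slot i (suc t) = refl

  decodeE-encodeE : ∀ d → decodeE (encodeE d) ≡ d
  decodeE-encodeE (stem i)    = cong (uncurry slot) (remQuot-combine i zero)
  decodeE-encodeE (spoke i t) = cong (uncurry slot) (remQuot-combine i (suc t))

  encodeE-decodeE : ∀ e → encodeE (decodeE e) ≡ e
  encodeE-decodeE e = trans (uncurry encodeE-slot (remQuot n e)) (combine-remQuot {k} n e)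

  encodeV-partner : ∀ d → encodeV (partner d) ≡ suc (encodeE d)
  encodeV-partner (stem i)    = refl
  encodeV-partner (spoke i t) = refl

  decodeV-encodeV : ∀ x → decodeV (encodeV x) ≡ x
  decodeV-encodeV root       = refl
  decodeV-encodeV (centre i) = cong partner (decodeE-encodeE (stem i))
  decodeV-encodeV (leaf i t) = cong partner (decodeE-encodeE (spoke i t))

  encodeV-decodeV : ∀ a → encodeV (decodeV a) ≡ a
  encodeV-decodeV zero    = refl
  encodeV-decodeV (suc x) = trans (encodeV-partner (decodeE x)) (cong suc (encodeE-decodeE x))

  encodeV-injective : Injective _≡_ _≡_ encodeV
  encodeV-injective {x} {y} eq = trans (sym (decodeV-encodeV x)) (trans (cong decodeV eq) (decodeV-encodeV y))

  decodeV-injective : Injective _≡_ _≡_ decodeV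
  decodeV-injective {a} {b} eq = trans (sym (encodeV-decodeV a)) (trans (cong encodeV eq) (encodeV-decodeV b))

  data Incident : Vertex → Vertex → Edge → Set where
    stem-incident  : ∀ i → Incident root (leaf i zero) (stem i)
    spoke-incident : ∀ i t → Incident (centre i) (leaf i t) (spoke i t)

  Joins : Vertex → Vertex → Edge → Set
  Joins x y d = Incident x y d ⊎ Incident y x d

  source target : Edge → Vertex
  source (stem i)    = root
  source (spoke i t) = centre i
  target (stem i)    = leaf i zero
  target (spoke i t) = leaf i t

  incident : ∀ d → Incident (source d) (target d) d
  incident (stem i)    = stem-incident i
  incident (spoke i t) = spoke-incident i t

  endpoints : Edge → Fin (nV Γ) × Fin (nV Γ)
  endpoints d = encodeV (source d) , encodeV (target d)

  ends-combine : ∀ i j → ends Γ (combine i j) ≡ endpoints (slot i j)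
  ends-combine i j rewrite remQuot-combine {k} {n} i j with j
  ... | zero  = refl
  ... | suc t = refl

  ends-decodeE : ∀ e → ends Γ e ≡ endpoints (decodeE e)
  ends-decodeE e = trans (cong (ends Γ) (sym (combine-remQuot {k} n e))) (uncurry ends-combine (remQuot n e))

  ends-encodeE : ∀ d → ends Γ (encodeE d) ≡ endpoints d
  ends-encodeE (stem i)    = ends-combine i zero
  ends-encodeE (spoke i t) = ends-combine i (suc t)

  incident-at : ∀ {a b d} → endpoints d ≡ (a , b) → Incident (decodeV a) (decodeV b) d
  incident-at {d = d} refl rewrite decodeV-encodeV (source d) | decodeV-encodeV (target d) = incident d

  adjacent⇒joins : ∀ {a b e} → Adjacent Γ a b e → Joins (decodeV a) (decodeV b) (decodeE e)
  adjacent⇒joins {e = e} (inj₁ eq) = inj₁ (incident-at (trans (sym (ends-decodeE e)) eq))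
  adjacent⇒joins {e = e} (inj₂ eq) = inj₂ (incident-at (trans (sym (ends-decodeE e)) eq))

  joins-sym : ∀ {x y d} → Joins x y d → Joins y x d
  joins-sym = Sum.swap

  root-neighbour : ∀ {y d} → Joins root y d → ∃ λ i → y ≡ leaf i zero
  root-neighbour (inj₁ (stem-incident i)) = i , refl

  centre-neighbour : ∀ {i y d} → Joins (centre i) y d → ∃ λ t → y ≡ leaf i t × d ≡ spoke i t
  centre-neighbour (inj₁ (spoke-incident i t)) = t , refl , refl

  leaf-neighbour : ∀ {i t y d} → Joins (leaf i t) y d → (y ≡ root × d ≡ stem i) ⊎ (y ≡ centre i × d ≡ spoke i t)
  leaf-neighbour (inj₂ (stem-incident i))    = inj₁ (refl , refl)
  leaf-neighbour (inj₂ (spoke-incident i t)) = inj₂ (refl , refl)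

module CopyInBananaTree (k m : ℕ) (k≤m : k ≤ m) (2≤m : 2 ≤ m) (c : Copy (banana 1 (suc (suc m))) (banana k (suc (suc m)))) where

  open BananaTree k m
  module S = BananaTree 1 m

  vmap : S.Vertex → Vertex
  vmap = decodeV ∘ φV c ∘ S.encodeV

  emap : S.Edge → Edge
  emap = decodeE ∘ φE c ∘ S.encodeE

  vmap-injective : Injective _≡_ _≡_ vmap
  vmap-injective = S.encodeV-injective ∘ φV-inj c ∘ decodeV-injective

  joins-image : ∀ d → Joins (vmap (S.source d)) (vmap (S.target d)) (emap d)
  joins-image d =
    adjacent⇒joins (subst (λ (a , b) → Adjacent Γ (φV c a) (φV c b) (φE c e)) (S.ends-encodeE d) (φ-edge c e))
    where
    e : Fin (nE S.Γ)
    e = S.encodeE d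

  leafImage : Fin (suc m) → Vertex
  leafImage t = vmap (S.leaf zero t)

  leafImage-injective : Injective _≡_ _≡_ leafImage
  leafImage-injective {t} {t′} eq with refl ← vmap-injective {S.leaf zero t} {S.leaf zero t′} eq = refl

  spoke-image : ∀ t → Joins (vmap (S.centre zero)) (leafImage t) (emap (S.spoke zero t))
  spoke-image t = joins-image (S.spoke zero t)

  centre-image : ∃ λ i → vmap (S.centre zero) ≡ centre i
  centre-image = hub-is-centre (vmap (S.centre zero)) spoke-image
    where
    hub-is-centre : ∀ x → (∀ t → Joins x (leafImage t) (emap (S.spoke zero t))) → ∃ λ i → x ≡ centre i
    hub-is-centre root spokes = ⊥-elim (<⇒≱ (s≤s k≤m)
      (injective-into-image⇒≤ leafImage-injective (λ i → leaf i zero) (root-neighbour ∘ spokes)))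
    hub-is-centre (centre i) _ = i , refl
    hub-is-centre (leaf i t) spokes = ⊥-elim (<⇒≱ (s≤s 2≤m)
      (injective-into-image⇒≤ leafImage-injective rootOrCentre (towards-rootOrCentre ∘ spokes)))
      where
      rootOrCentre : Fin 2 → Vertex
      rootOrCentre zero    = root
      rootOrCentre (suc _) = centre i
      towards-rootOrCentre : ∀ {y d} → Joins (leaf i t) y d → ∃ λ b → y ≡ rootOrCentre b
      towards-rootOrCentre j with leaf-neighbour j
      ... | inj₁ (y≡root , _)   = zero , y≡root
      ... | inj₂ (y≡centre , _) = suc zero , y≡centre

  hub : Fin k
  hub = proj₁ centre-image

  leaf-image : ∀ t → ∃ λ t′ → leafImage t ≡ leaf hub t′ × emap (S.spoke zero t) ≡ spoke hub t′
  leaf-image t =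
    centre-neighbour (subst (λ x → Joins x (leafImage t) (emap (S.spoke zero t))) (proj₂ centre-image) (spoke-image t))

  root-image : vmap S.root ≡ root × emap (S.stem zero) ≡ stem hub
  root-image with leaf-neighbour (joins-sym (subst (λ y → Joins (vmap S.root) y (emap (S.stem zero)))
                                                   (proj₁ (proj₂ (leaf-image zero))) (joins-image (S.stem zero))))
  ... | inj₁ image = image
  ... | inj₂ (root↦centre , _)
    with () ← vmap-injective {S.root} {S.centre zero} (trans root↦centre (sym (proj₂ centre-image)))

  partner-image : ∀ d → vmap (S.partner d) ≡ partner (emap d)
  partner-image (S.stem zero)    = trans (proj₂ centre-image) (cong partner (sym (proj₂ root-image)))
  partner-image (S.spoke zero t) =
    trans (proj₁ (proj₂ (leaf-image t))) (cong partner (sym (proj₂ (proj₂ (leaf-image t)))))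

  φV-root : φV c zero ≡ zero
  φV-root = trans (sym (encodeV-decodeV (φV c zero))) (cong encodeV (proj₁ root-image))

  φV-suc : ∀ x → φV c (suc x) ≡ suc (φE c x)
  φV-suc x = begin
    φV c (suc x)                    ≡⟨ cong (φV c) (trans (S.encodeV-partner d) (cong suc (S.encodeE-decodeE x))) ⟨
    φV c (S.encodeV (S.partner d))  ≡⟨ encodeV-decodeV _ ⟨
    encodeV (vmap (S.partner d))    ≡⟨ cong encodeV (partner-image d) ⟩
    encodeV (partner (emap d))      ≡⟨ encodeV-partner (emap d) ⟩
    suc (encodeE (emap d))          ≡⟨ cong suc (encodeE-decodeE _) ⟩
    suc (φE c (S.encodeE d))        ≡⟨ cong (suc ∘ φE c) (S.encodeE-decodeE x) ⟩
    suc (φE c x)                    ∎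
    where
    open ≡-Reasoning
    d : S.Edge
    d = S.decodeE x

  weight-edgeReversed : weight S.Γ Γ (edgeReversed Γ) c ≡ suc (Σ-Fin {nE S.Γ} λ _ → suc (suc (nV Γ + nE Γ)))
  weight-edgeReversed = begin
    (F zero + Σ-Fin (F ∘ suc)) + Σ-Fin G                ≡⟨ +-assoc (F zero) _ _ ⟩
    F zero + (Σ-Fin (F ∘ suc) + Σ-Fin G)                ≡⟨ cong₂ _+_ F-root (Σ-Fin-+ (F ∘ suc) G) ⟩
    1 + Σ-Fin (λ x → F (suc x) + G x)                   ≡⟨ cong (1 +_) (Σ-Fin-cong pair) ⟩
    1 + Σ-Fin {nE S.Γ} (λ _ → suc (suc (nV Γ + nE Γ)))  ∎
    where
    open ≡-Reasoning
    F : Fin (nV S.Γ) → ℕ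
    F = label Γ (edgeReversed Γ) ∘ inj₁ ∘ φV c
    G : Fin (nE S.Γ) → ℕ
    G = label Γ (edgeReversed Γ) ∘ inj₂ ∘ φE c
    F-root : F zero ≡ 1
    F-root = trans (label-vertex Γ _) (cong (suc ∘ toℕ) φV-root)
    pair : ∀ x → F (suc x) + G x ≡ suc (suc (nV Γ + nE Γ))
    pair x = label-pair Γ _ _ (cong toℕ (φV-suc x))

isSupermagic-banana : ∀ {k m} → k ≤ m → 2 ≤ m → IsSupermagic (banana k (2 + m)) (banana 1 (2 + m))
isSupermagic-banana {k} {m} k≤m 2≤m =
  isSupermagic-edgeReversed _ (CopyInBananaTree.weight-edgeReversed k m k≤m 2≤m)

mainTheorem3 : ∀ (k n : ℕ) → 1 ≤ k → k + 2 ≤ n → IsSupermagic (banana k n) (banana 1 n)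
mainTheorem3 zero          _             () _
mainTheorem3 (suc zero)    n             _ _       = isSupermagic-self (banana 1 n)
mainTheorem3 (suc (suc k)) (suc (suc m)) _ k+4≤n   = isSupermagic-banana k+2≤m (≤-trans (s≤s (s≤s z≤n)) k+2≤m)
  where
  k+2≤m : suc (suc k) ≤ m
  k+2≤m = subst (_≤ m) (+-comm k 2) (s≤s⁻¹ (s≤s⁻¹ k+4≤n))
mainTheorem3 (suc (suc k)) (suc zero)    _ (s≤s ())
mainTheorem3 (suc (suc k)) zero          _ ()
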